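{- For any combinatorial proof $h:G\to P$ of a combinatorial proposition $P$, there exist a combinatorial proposition $P'$ and a shallow combinatorial proof $h':G\to P'$ of $P'$ such that $P$ is true if and only if $P'$ is true.
   Context: A graph $(V,E)$: finite $V$, $E$ a set of two-element subsets of $V$; write $vw$. A homomorphism $h:G\to G'$ satisfies $vw\in E(G)\Rightarrow h(v)h(w)\in E(G')$; it is a skew fibration if for every $v\in V(G)$ and every $w$ with $h(v)w\in E(G')$ there is $\hat w$ with $v\hat w\in E(G)$ and $h(\hat w)w\notin E(G')$. A cograph is a graph with nonempty vertex set such that for distinct $v,w,x,y$ the edges among $\{v,w,x,y\}$ are not exactly $\{vw,wx,xy\}$. Atoms: literals $p,\overline p$ and constants $0,1$; $p,\overline p$ dual. A combinatorial proposition is a cograph with an atom label on each vertex. Stable set: contains no edge; clause: maximal stable set; a clause is true if it contains a $1$-labelled vertex or two vertices labelled by dual literals; a labelled graph is true if all its clauses are true. A coloured graph has an equivalence relation $\sim$ on vertices with $v\sim w$, $v\ne w$ implying $vw\notin E$; classes are colour classes. $W$ induces a matching if $W\ne\emptyset$ and each $w\in W$ has a unique $w'\in W$ with $ww'\in E$. Nice (nicely coloured): every colour class has at most two vertices and no union of two-vertex colour classes induces a matching. A combinatorial proof of $P$ is a skew fibration $h:C\to P$ from a nicely coloured cograph $C$ whose colour classes are axiomatic: a class $\{v\}$ with $h(v)$ labelled $1$, or a class $\{v,w\}$ with $h(v),h(w)$ labelled by dual literals. A graph is disconnected if it is a union of two nonempty graphs (with no edges between them), connected otherwise; a component is a maximal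 nonempty connected subgraph. A homomorphism $h:G\to H$ is shallow if for every component $K$ of $H$, the induced subgraph of $G$ on $h^{ -1}(V(K))$ has at most one component. -}

module Defs where

open import Data.Nat using (ℕ; _≥_)
open import Data.Fin using (Fin)
open import Data.Bool using (Bool; true; false)
open import Data.Product using (Σ; ∃; ∃-syntax; _×_; _,_)
open import Data.Sum using (_⊎_)
open import Data.Empty using (⊥)
open import Relation.Nullary using (¬_)
open import Relation.Binary.PropositionalEquality using (_≡_; _≢_)

-- Graphs: finite vertex set Fin n; the edge set (a set of two-element
-- subsets) is represented by a symmetric irreflexive Boolean relation.

record Graph : Set where
  field
    n      : ℕ
    adj    : Fin n → Fin n → Bool
    sym    : ∀ v w → adj v w ≡ adj w v
    irrefl : ∀ v → adj v v ≡ false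

open Graph public

Edge : (G : Graph) → Fin (n G) → Fin (n G) → Set
Edge G v w = adj G v w ≡ true

VSet : Graph → Set
VSet G = Fin (n G) → Bool

_∈_ : ∀ {m : ℕ} → Fin m → (Fin m → Bool) → Set
x ∈ S = S x ≡ true

_⊆_ : ∀ {m : ℕ} → (Fin m → Bool) → (Fin m → Bool) → Set
_⊆_ {m} S T = ∀ (x : Fin m) → x ∈ S → x ∈ T

IsHom : (G H : Graph) → (Fin (n G) → Fin (n H)) → Set
IsHom G H h = ∀ v w → Edge G v w → Edge H (h v) (h w)

IsSkewFibration : (G H : Graph) → (Fin (n G) → Fin (n H)) → Set
IsSkewFibration G H h =
  IsHom G H h ×
  (∀ (v : Fin (n G)) (w : Fin (n H)) → Edge H (h v) w →
     ∃[ ŵ ] (Edge G v ŵ × ¬ Edge H (h ŵ) w))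

IsCograph : Graph → Set
IsCograph G =
  n G ≥ 1 ×
  (∀ (v w x y : Fin (n G)) →
     v ≢ w → v ≢ x → v ≢ y → w ≢ x → w ≢ y → x ≢ y →
     ¬ (Edge G v w × Edge G w x × Edge G x y ×
        ¬ Edge G v x × ¬ Edge G v y × ¬ Edge G w y))

data Atom : Set where
  pos  : ℕ → Atom
  neg  : ℕ → Atom
  𝟘    : Atom
  𝟙    : Atom

Dual : Atom → Atom → Set
Dual (pos p) (neg q) = p ≡ q
Dual (neg p) (pos q) = p ≡ q
Dual _       _       = ⊥

record CombProp : Set where
  field
    graph   : Graph
    cograph : IsCograph graph
    label   : Fin (n graph) → Atom

open CombProp public

Stable : (G : Graph) → VSet G → Set
Stable G S = ∀ v w → v ∈ S → w ∈ S → ¬ Edge G v w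

IsClause : (G : Graph) → VSet G → Set
IsClause G S = Stable G S × (∀ (T : VSet G) → Stable G T → S ⊆ T → T ⊆ S)

TrueClause : (P : CombProp) → VSet (graph P) → Set
TrueClause P S =
  (∃[ v ] (v ∈ S × label P v ≡ 𝟙)) ⊎
  (∃[ v ] ∃[ w ] (v ∈ S × w ∈ S × Dual (label P v) (label P w)))

IsTrue : CombProp → Set
IsTrue P = ∀ (S : VSet (graph P)) → IsClause (graph P) S → TrueClause P S

record ColouredGraph : Set where
  field
    graph  : Graph
    col    : Fin (n graph) → Fin (n graph) → Bool
    col-refl  : ∀ v → col v v ≡ true
    col-sym   : ∀ v w → col v w ≡ true → col w v ≡ true
    col-trans : ∀ u v w → col u v ≡ true → col v w ≡ true → col u w ≡ true
    col-noedge : ∀ v w → col v w ≡ true → v ≢ w → ¬ Edge graph v w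

open ColouredGraph public using (col)

module _ (C : ColouredGraph) where
  private
    G = ColouredGraph.graph C

  _∼_ : Fin (n G) → Fin (n G) → Set
  v ∼ w = col C v w ≡ true

  InducesMatching : VSet G → Set
  InducesMatching W =
    (∃[ w ] w ∈ W) ×
    (∀ w → w ∈ W →
       ∃[ w' ] (w' ∈ W × Edge G w w' ×
                (∀ u → u ∈ W → Edge G w u → u ≡ w')))

  InTwoClass : Fin (n G) → Set
  InTwoClass v = ∃[ w ] (w ≢ v × v ∼ w × (∀ x → v ∼ x → x ≡ v ⊎ x ≡ w))

  UnionOfTwoClasses : VSet G → Set
  UnionOfTwoClasses W =
    (∀ w → w ∈ W → InTwoClass w) × (∀ v w → v ∈ W → v ∼ w → w ∈ W)

  IsNice : Set
  IsNice =
    (∀ v x y z → v ∼ x → v ∼ y → v ∼ z → x ≡ y ⊎ x ≡ z ⊎ y ≡ z) ×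
    (∀ (W : VSet G) → UnionOfTwoClasses W → ¬ InducesMatching W)

  Axiomatic : (P : CombProp) → (Fin (n G) → Fin (n (graph P))) → Set
  Axiomatic P h = ∀ v →
    ((∀ x → v ∼ x → x ≡ v) × label P (h v) ≡ 𝟙) ⊎
    (∃[ w ] (w ≢ v × v ∼ w × (∀ x → v ∼ x → x ≡ v ⊎ x ≡ w) ×
             Dual (label P (h v)) (label P (h w))))

IsCombProof : (C : ColouredGraph) (P : CombProp) →
              (Fin (n (ColouredGraph.graph C)) → Fin (n (graph P))) → Set
IsCombProof C P h =
  IsCograph (ColouredGraph.graph C) × IsNice C ×
  IsSkewFibration (ColouredGraph.graph C) (graph P) h ×
  Axiomatic C P h

Disconnected : (G : Graph) → VSet G → Set
Disconnected G S = ∃[ A ] ∃[ B ]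
  ((∀ x → x ∈ S → x ∈ A ⊎ x ∈ B) × A ⊆ S × B ⊆ S ×
   (∀ x → x ∈ A → x ∈ B → ⊥) ×
   (∃[ a ] a ∈ A) × (∃[ b ] b ∈ B) ×
   (∀ a b → a ∈ A → b ∈ B → ¬ Edge G a b))

Connected : (G : Graph) → VSet G → Set
Connected G S = ¬ Disconnected G S

ComponentIn : (G : Graph) → VSet G → VSet G → Set
ComponentIn G S K =
  K ⊆ S × (∃[ k ] k ∈ K) × Connected G K ×
  (∀ (T : VSet G) → K ⊆ T → T ⊆ S → (∃[ t ] t ∈ T) → Connected G T → T ⊆ K)

Component : (G : Graph) → VSet G → Set
Component G K = ComponentIn G (λ _ → true) K

IsShallow : (G H : Graph) → (Fin (n G) → Fin (n H)) → Set
IsShallow G H h = ∀ (K : VSet H) → Component H K →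
  ∀ (K₁ K₂ : VSet G) →
    ComponentIn G (λ v → K (h v)) K₁ → ComponentIn G (λ v → K (h v)) K₂ →
    (∀ x → K₁ x ≡ K₂ x)

-- In a cograph, "distance at most two" is an equivalence relation, since an induced path on four
-- vertices is excluded; its classes are the components.  Let P' have vertices (u , x) for u in G
-- and x in P, with (u , x)(v , y) an edge when u, v lie in one component of G and xy is an edge of
-- P.  Then v ↦ (v , h v) is again a combinatorial proof.  Each component of P' lies over a single
-- component of G, and its preimage has diameter at most two, hence is connected.  Clauses of P
-- lift to clauses of P', and a clause of P' meets each copy {u} × P in a clause of P, so P and P'
-- are true together.
module Submission where

open import Defs
open import Data.Fin using (Fin)
open import Data.Product using (Σ; ∃; ∃-syntax; _×_)
open import Function.Bundles using (_⇔_)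

open import Level using (0ℓ)
open import Data.Nat using (ℕ; _*_; _≥_)
open import Data.Nat.Properties using (*-mono-≤)
open import Data.Fin using (combine; remQuot; fromℕ<; _≟_)
open import Data.Fin.Properties using (remQuot-combine; combine-remQuot; any?)
open import Data.Bool using (Bool; true; false; _∧_; _∨_)
open import Data.Bool.Properties using (∧-conicalˡ; ∧-conicalʳ; ∧-zeroʳ; ∨-zeroʳ)
  renaming (_≟_ to _≟ᵇ_)
open import Data.Product using (_,_; proj₁; proj₂)
open import Data.Sum using (_⊎_; inj₁; inj₂; swap; [_,_])
import Data.Sum as Sum
open import Data.Empty using (⊥; ⊥-elim)
open import Function.Base using (_∘_)
open import Function.Bundles using (mk⇔)
open import Relation.Nullary using (¬_; Dec; yes; no; does)
open import Relation.Nullary.Decidable using (dec-true; does-⇔; toSum; ¬?; _⊎-dec_; _×-dec_)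
open import Relation.Unary using (Pred) renaming (Decidable to Decidable₁)
open import Relation.Binary using (Rel; Decidable; IsDecEquivalence)
open import Relation.Binary.PropositionalEquality using (_≡_; _≢_; refl; cong; cong₂; subst; subst₂)
import Relation.Binary.PropositionalEquality as ≡

dec-true⁻¹ : ∀ {A : Set} (a? : Dec A) → does a? ≡ true → A
dec-true⁻¹ (yes a) _ = a

module _ {m : ℕ} where

  -- opaque, so that the sets in membership goals stay visible to unification
  opaque

    _∪_ _∩_ : (Fin m → Bool) → (Fin m → Bool) → Fin m → Bool
    (S ∪ T) x = S x ∨ T x
    (S ∩ T) x = S x ∧ T x

    ⟦_⟧ : {Q : Pred (Fin m) 0ℓ} → Decidable₁ Q → Fin m → Bool
    ⟦ Q? ⟧ x = does (Q? x)

    ｛_｝ : Fin m → Fin m → Bool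
    ｛ z ｝ = ⟦ _≟ z ⟧

    ∈-∪⁺ˡ : ∀ {S T x} → x ∈ S → x ∈ (S ∪ T)
    ∈-∪⁺ˡ {T = T} {x} x∈S = cong (_∨ T x) x∈S

    ∈-∪⁺ʳ : ∀ {S T x} → x ∈ T → x ∈ (S ∪ T)
    ∈-∪⁺ʳ {S} {x = x} x∈T = ≡.trans (cong (S x ∨_) x∈T) (∨-zeroʳ (S x))

    ∈-∪⁻ : ∀ S T x → x ∈ (S ∪ T) → x ∈ S ⊎ x ∈ T
    ∈-∪⁻ S T x x∈S∪T with S x
    ... | true  = inj₁ refl
    ... | false = inj₂ x∈S∪T

    ∈-∩⁺ : ∀ {S T x} → x ∈ S → x ∈ T → x ∈ (S ∩ T)
    ∈-∩⁺ = cong₂ _∧_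

    ∈-∩⁻ : ∀ {S T x} → x ∈ (S ∩ T) → x ∈ S × x ∈ T
    ∈-∩⁻ {S} {T} {x} x∈S∩T = ∧-conicalˡ (S x) (T x) x∈S∩T , ∧-conicalʳ (S x) (T x) x∈S∩T

    ∈⟦⟧⁺ : ∀ {Q} (Q? : Decidable₁ Q) {x} → Q x → x ∈ ⟦ Q? ⟧
    ∈⟦⟧⁺ Q? {x} = dec-true (Q? x)

    ∈⟦⟧⁻ : ∀ {Q} (Q? : Decidable₁ Q) {x} → x ∈ ⟦ Q? ⟧ → Q x
    ∈⟦⟧⁻ Q? {x} = dec-true⁻¹ (Q? x)

    ∈｛｝ : ∀ {x} → x ∈ ｛ x ｝
    ∈｛｝ {x} = ∈⟦⟧⁺ (_≟ x) refl

    ∈｛｝⁻ : ∀ {x y} → y ∈ ｛ x ｝ → y ≡ x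
    ∈｛｝⁻ {x} = ∈⟦⟧⁻ (_≟ x)

  ⊆-antisym : ∀ {S T : Fin m → Bool} → S ⊆ T → T ⊆ S → ∀ x → S x ≡ T x
  ⊆-antisym {S} {T} S⊆T T⊆S x with S x in Sx | T x in Tx
  ... | true  | true  = refl
  ... | false | false = refl
  ... | true  | false = ≡.trans (≡.sym (S⊆T x Sx)) Tx
  ... | false | true  = ≡.trans (≡.sym Sx) (T⊆S x Tx)

module _ (H : Graph) where

  edge? : Decidable (Edge H)
  edge? a b = adj H a b ≟ᵇ true

  edge-sym : ∀ {a b} → Edge H a b → Edge H b a
  edge-sym {a} {b} = ≡.trans (Graph.sym H b a)

  edge⇒≢ : ∀ {a b} → Edge H a b → a ≢ b
  edge⇒≢ {a} ab refl with () ← ≡.trans (≡.sym ab) (irrefl H a)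

  edge-closed⇒all : ∀ {K} {Q : Pred (Fin (n H)) 0ℓ} (Q? : Decidable₁ Q) → Connected H K →
    (∀ a b → a ∈ K → b ∈ K → Q a → Edge H a b → Q b) →
    ∀ {k} → k ∈ K → Q k → ∀ x → x ∈ K → Q x
  edge-closed⇒all {K} {Q} Q? K-connected closed {k} k∈K Qk x x∈K with Q? x
  ... | yes Qx = Qx
  ... | no ¬Qx = ⊥-elim (K-connected
    ( K ∩ ⟦ Q? ⟧ , K ∩ ⟦ ¬Q? ⟧ , cover , (λ _ → proj₁ ∘ ∈-∩⁻) , (λ _ → proj₁ ∘ ∈-∩⁻)
    , (λ y y∈A y∈B → inQ⁻ y∈B (inQ y∈A))
    , (k , ∈-∩⁺ k∈K (∈⟦⟧⁺ Q? Qk)) , (x , ∈-∩⁺ x∈K (∈⟦⟧⁺ ¬Q? ¬Qx))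
    , λ a b a∈A b∈B ab → inQ⁻ b∈B (closed a b (proj₁ (∈-∩⁻ a∈A)) (proj₁ (∈-∩⁻ b∈B)) (inQ a∈A) ab)))
    where
    ¬Q? : Decidable₁ (¬_ ∘ Q)
    ¬Q? y = ¬? (Q? y)
    cover : ∀ y → y ∈ K → y ∈ (K ∩ ⟦ Q? ⟧) ⊎ y ∈ (K ∩ ⟦ ¬Q? ⟧)
    cover y y∈K = Sum.map (∈-∩⁺ y∈K ∘ ∈⟦⟧⁺ Q?) (∈-∩⁺ y∈K ∘ ∈⟦⟧⁺ ¬Q?) (toSum (Q? y))
    inQ : ∀ {y} → y ∈ (K ∩ ⟦ Q? ⟧) → Q y
    inQ = ∈⟦⟧⁻ Q? ∘ proj₂ ∘ ∈-∩⁻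
    inQ⁻ : ∀ {y} → y ∈ (K ∩ ⟦ ¬Q? ⟧) → ¬ Q y
    inQ⁻ = ∈⟦⟧⁻ ¬Q? ∘ proj₂ ∘ ∈-∩⁻

  connected-∪-neighbour : ∀ {K k z} → Connected H K → k ∈ K → Edge H k z → Connected H (K ∪ ｛ z ｝)
  connected-∪-neighbour {K} {k} {z} K-connected k∈K kz
    (A , B , cover , A⊆T , B⊆T , disjoint , (a , a∈A) , (b , b∈B) , noEdge)
    = [ (λ k∈A → sideOf-k A B cover B⊆T disjoint noEdge k∈A b∈B)
      , (λ k∈B → sideOf-k B A (λ x → swap ∘ cover x) A⊆T (λ x p q → disjoint x q p)
                   (λ x y p q → noEdge y x q p ∘ edge-sym) k∈B a∈A)
      ] (cover k (∈-∪⁺ˡ k∈K))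
    where
    T : VSet H
    T = K ∪ ｛ z ｝
    sideOf-k : ∀ A B → (∀ x → x ∈ T → x ∈ A ⊎ x ∈ B) → B ⊆ T → (∀ x → x ∈ A → x ∈ B → ⊥) →
               (∀ x y → x ∈ A → y ∈ B → ¬ Edge H x y) → k ∈ A → ∀ {b} → b ∈ B → ⊥
    sideOf-k A B cover B⊆T disjoint noEdge k∈A {b} b∈B = disjoint b (T⊆A b (B⊆T b b∈B)) b∈B
      where
      stepA : ∀ {x y} → x ∈ A → y ∈ T → Edge H x y → y ∈ A
      stepA {x} {y} x∈A y∈T xy with cover y y∈T
      ... | inj₁ y∈A = y∈A
      ... | inj₂ y∈B = ⊥-elim (noEdge x y x∈A y∈B xy)
      K⊆A : K ⊆ A
      K⊆A = edge-closed⇒all (λ x → A x ≟ᵇ true) K-connected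
              (λ _ _ _ b∈K a∈A ab → stepA a∈A (∈-∪⁺ˡ b∈K) ab) k∈K k∈A
      T⊆A : T ⊆ A
      T⊆A x x∈T with ∈-∪⁻ K ｛ z ｝ x x∈T
      ... | inj₁ x∈K = K⊆A x x∈K
      ... | inj₂ x∈z with refl ← ∈｛｝⁻ x∈z = stepA k∈A x∈T kz

  component-closed : ∀ {K} → Component H K → ∀ {k z} → k ∈ K → Edge H k z → z ∈ K
  component-closed {K} (_ , _ , K-connected , maximal) {k} {z} k∈K kz =
    maximal (K ∪ ｛ z ｝) (λ _ → ∈-∪⁺ˡ) (λ _ _ → refl) (k , ∈-∪⁺ˡ k∈K)
      (connected-∪-neighbour K-connected k∈K kz) z (∈-∪⁺ʳ ∈｛｝)

  component-of-connected : ∀ {S K} → ComponentIn H S K → Connected H S → ∀ x → K x ≡ S x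
  component-of-connected {S} {K} (K⊆S , (k , k∈K) , _ , maximal) S-connected =
    ⊆-antisym {S = K} K⊆S (maximal S K⊆S (λ _ x∈S → x∈S) (k , K⊆S k k∈K) S-connected)

  diameter≤2⇒connected : ∀ {S} →
    (∀ a b → a ∈ S → b ∈ S → a ≡ b ⊎ Edge H a b ⊎ ∃[ z ] (z ∈ S × Edge H a z × Edge H z b)) →
    Connected H S
  diameter≤2⇒connected close (A , B , cover , A⊆S , B⊆S , disjoint , (a , a∈A) , (b , b∈B) , noEdge)
    with close a b (A⊆S a a∈A) (B⊆S b b∈B)
  ... | inj₁ refl = disjoint a a∈A b∈B
  ... | inj₂ (inj₁ ab) = noEdge a b a∈A b∈B ab
  ... | inj₂ (inj₂ (z , z∈S , az , zb)) with cover z z∈S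
  ...   | inj₁ z∈A = noEdge z b z∈A b∈B zb
  ...   | inj₂ z∈B = noEdge a z a∈A z∈B az

  clause-∋-if-neighbours-⊆ : ∀ {S} → IsClause H S → ∀ {i e} → i ∈ S →
    (∀ v → Edge H v e → Edge H v i) → e ∈ S
  clause-∋-if-neighbours-⊆ {S} (S-stable , S-maximal) {i} {e} i∈S N[e]⊆N[i] =
    S-maximal (S ∪ ｛ e ｝) stable (λ _ → ∈-∪⁺ˡ) e (∈-∪⁺ʳ ∈｛｝)
    where
    ∈S∪e⁻ : ∀ {v} → v ∈ (S ∪ ｛ e ｝) → v ∈ S ⊎ v ≡ e
    ∈S∪e⁻ {v} = Sum.map₂ ∈｛｝⁻ ∘ ∈-∪⁻ S ｛ e ｝ v
    stable : Stable H (S ∪ ｛ e ｝)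
    stable v w v∈ w∈ vw with ∈S∪e⁻ v∈ | ∈S∪e⁻ w∈
    ... | inj₁ v∈S  | inj₁ w∈S  = S-stable v w v∈S w∈S vw
    ... | inj₁ v∈S  | inj₂ refl = S-stable v i v∈S i∈S (N[e]⊆N[i] v vw)
    ... | inj₂ refl | inj₁ w∈S  = S-stable w i w∈S i∈S (N[e]⊆N[i] w (edge-sym vw))
    ... | inj₂ refl | inj₂ refl = edge⇒≢ vw refl

trueClause-map : (P Q : CombProp) {S : VSet (graph P)} {T : VSet (graph Q)}
  (f : Fin (n (graph P)) → Fin (n (graph Q))) → (∀ x → label Q (f x) ≡ label P x) →
  (∀ x → x ∈ S → f x ∈ T) → TrueClause P S → TrueClause Q T
trueClause-map P Q f label-f S→T (inj₁ (x , x∈S , x≡𝟙)) =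
  inj₁ (f x , S→T x x∈S , ≡.trans (label-f x) x≡𝟙)
trueClause-map P Q f label-f S→T (inj₂ (x , y , x∈S , y∈S , dual)) =
  inj₂ (f x , f y , S→T x x∈S , S→T y y∈S , subst₂ Dual (≡.sym (label-f x)) (≡.sym (label-f y)) dual)

Dist≤2 : (G : Graph) → Rel (Fin (n G)) 0ℓ
Dist≤2 G u v = u ≡ v ⊎ Edge G u v ⊎ ∃[ z ] (Edge G u z × Edge G z v)

module _ {G : Graph} where

  dist≤2? : Decidable (Dist≤2 G)
  dist≤2? u v = (u ≟ v) ⊎-dec (edge? G u v ⊎-dec any? (λ z → edge? G u z ×-dec edge? G z v))

  dist≤2-sym : ∀ {u v} → Dist≤2 G u v → Dist≤2 G v u
  dist≤2-sym (inj₁ refl) = inj₁ refl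
  dist≤2-sym (inj₂ (inj₁ uv)) = inj₂ (inj₁ (edge-sym G uv))
  dist≤2-sym (inj₂ (inj₂ (z , uz , zv))) = inj₂ (inj₂ (z , edge-sym G zv , edge-sym G uz))

  module _ (G-cograph : IsCograph G) where

    path₃⇒dist≤2 : ∀ {a b c d} → Edge G a b → Edge G b c → Edge G c d → Dist≤2 G a d
    path₃⇒dist≤2 {a} {b} {c} {d} ab bc cd
      with a ≟ c | b ≟ d | a ≟ d | edge? G a c | edge? G b d | edge? G a d
    ... | yes refl | _      | _      | _      | _      | _      = inj₂ (inj₁ cd)
    ... | no _     | yes refl | _    | _      | _      | _      = inj₂ (inj₁ ab)
    ... | no _     | no _   | yes ad | _      | _      | _      = inj₁ ad
    ... | no _     | no _   | no _   | yes ac | _      | _      = inj₂ (inj₂ (c , ac , cd))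
    ... | no _     | no _   | no _   | no _   | yes bd | _      = inj₂ (inj₂ (b , ab , bd))
    ... | no _     | no _   | no _   | no _   | no _   | yes ad = inj₂ (inj₁ ad)
    ... | no a≢c   | no b≢d | no a≢d | no ¬ac | no ¬bd | no ¬ad =
      ⊥-elim (proj₂ G-cograph a b c d (edge⇒≢ G ab) a≢c a≢d (edge⇒≢ G bc) b≢d (edge⇒≢ G cd)
                (ab , bc , cd , ¬ac , ¬ad , ¬bd))

    dist≤2-∷ʳ : ∀ {u v w} → Dist≤2 G u v → Edge G v w → Dist≤2 G u w
    dist≤2-∷ʳ (inj₁ refl) vw = inj₂ (inj₁ vw)
    dist≤2-∷ʳ (inj₂ (inj₁ uv)) vw = inj₂ (inj₂ (_ , uv , vw))
    dist≤2-∷ʳ (inj₂ (inj₂ (z , uz , zv))) vw = path₃⇒dist≤2 uz zv vw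

    dist≤2-trans : ∀ {u v w} → Dist≤2 G u v → Dist≤2 G v w → Dist≤2 G u w
    dist≤2-trans uv (inj₁ refl) = uv
    dist≤2-trans uv (inj₂ (inj₁ vw)) = dist≤2-∷ʳ uv vw
    dist≤2-trans uv (inj₂ (inj₂ (z , vz , zw))) = dist≤2-∷ʳ (dist≤2-∷ʳ uv vz) zw

    dist≤2-isDecEquivalence : IsDecEquivalence (Dist≤2 G)
    dist≤2-isDecEquivalence = record
      { isEquivalence = record { refl = inj₁ refl ; sym = dist≤2-sym ; trans = dist≤2-trans }
      ; _≟_ = dist≤2?
      }

module ClassProduct {m : ℕ} {_≈_ : Rel (Fin m) 0ℓ} (≈-isDecEquivalence : IsDecEquivalence _≈_)
                    (m≥1 : m ≥ 1) (P : CombProp) where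

  open IsDecEquivalence ≈-isDecEquivalence
    renaming (refl to ≈-refl; reflexive to ≈-reflexive; sym to ≈-sym; trans to ≈-trans; _≟_ to _≈?_)

  private
    GP : Graph
    GP = graph P
    k : ℕ
    k = n GP

  pair : Fin m → Fin k → Fin (m * k)
  pair = combine

  fst : Fin (m * k) → Fin m
  fst i = proj₁ (remQuot {m} k i)

  snd : Fin (m * k) → Fin k
  snd i = proj₂ (remQuot {m} k i)

  fst-pair : ∀ u x → fst (pair u x) ≡ u
  fst-pair u x = cong proj₁ (remQuot-combine u x)

  snd-pair : ∀ u x → snd (pair u x) ≡ x
  snd-pair u x = cong proj₂ (remQuot-combine u x)

  pair-fst-snd : ∀ i → pair (fst i) (snd i) ≡ i
  pair-fst-snd = combine-remQuot {m} k

  opaque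

    productAdj : Fin (m * k) → Fin (m * k) → Bool
    productAdj i j = does (fst i ≈? fst j) ∧ adj GP (snd i) (snd j)

    productAdj-sym : ∀ i j → productAdj i j ≡ productAdj j i
    productAdj-sym i j =
      cong₂ _∧_ (does-⇔ (mk⇔ ≈-sym ≈-sym) (fst i ≈? fst j) (fst j ≈? fst i)) (Graph.sym GP (snd i) (snd j))

    productAdj-irrefl : ∀ i → productAdj i i ≡ false
    productAdj-irrefl i = ≡.trans (cong (does (fst i ≈? fst i) ∧_) (irrefl GP (snd i))) (∧-zeroʳ _)

    productAdj⁺ : ∀ {i j} → fst i ≈ fst j → Edge GP (snd i) (snd j) → productAdj i j ≡ true
    productAdj⁺ {i} {j} ij = cong₂ _∧_ (dec-true (fst i ≈? fst j) ij)

    productAdj⁻ : ∀ {i j} → productAdj i j ≡ true → fst i ≈ fst j × Edge GP (snd i) (snd j)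
    productAdj⁻ {i} {j} ij =
      dec-true⁻¹ (fst i ≈? fst j) (∧-conicalˡ _ _ ij) , ∧-conicalʳ (does (fst i ≈? fst j)) _ ij

  productGraph : Graph
  productGraph = record { n = m * k ; adj = productAdj ; sym = productAdj-sym ; irrefl = productAdj-irrefl }

  edge⁺ : ∀ {i j} → fst i ≈ fst j → Edge GP (snd i) (snd j) → Edge productGraph i j
  edge⁺ = productAdj⁺

  edge⁻ : ∀ {i j} → Edge productGraph i j → fst i ≈ fst j × Edge GP (snd i) (snd j)
  edge⁻ = productAdj⁻

  pair-edge⁺ : ∀ {u v x y} → u ≈ v → Edge GP x y → Edge productGraph (pair u x) (pair v y)
  pair-edge⁺ {u} {v} {x} {y} uv xy =
    edge⁺ (subst₂ _≈_ (≡.sym (fst-pair u x)) (≡.sym (fst-pair v y)) uv)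
          (subst₂ (Edge GP) (≡.sym (snd-pair u x)) (≡.sym (snd-pair v y)) xy)

  pair-edge⁻ : ∀ {u x j} → Edge productGraph (pair u x) j → u ≈ fst j × Edge GP x (snd j)
  pair-edge⁻ {u} {x} uxj with edge⁻ uxj
  ... | uj , xj = subst (_≈ _) (fst-pair u x) uj , subst (λ y → Edge GP y _) (snd-pair u x) xj

  isCograph : IsCograph productGraph
  isCograph = *-mono-≤ m≥1 (proj₁ (cograph P)) , noInducedP₄
    where
    -- the four vertices lie in one ≈-class, so the path and its missing chords project to P
    noInducedP₄ : ∀ i₁ i₂ i₃ i₄ → i₁ ≢ i₂ → i₁ ≢ i₃ → i₁ ≢ i₄ → i₂ ≢ i₃ → i₂ ≢ i₄ → i₃ ≢ i₄ →
      ¬ (Edge productGraph i₁ i₂ × Edge productGraph i₂ i₃ × Edge productGraph i₃ i₄ ×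
         ¬ Edge productGraph i₁ i₃ × ¬ Edge productGraph i₁ i₄ × ¬ Edge productGraph i₂ i₄)
    noInducedP₄ i₁ i₂ i₃ i₄ _ _ _ _ _ _ (e₁₂ , e₂₃ , e₃₄ , ¬e₁₃ , ¬e₁₄ , ¬e₂₄) =
      proj₂ (cograph P) (snd i₁) (snd i₂) (snd i₃) (snd i₄)
        (edge⇒≢ GP f₁₂) x₁≢x₃ x₁≢x₄ (edge⇒≢ GP f₂₃) x₂≢x₄ (edge⇒≢ GP f₃₄)
        (f₁₂ , f₂₃ , f₃₄ , ¬f₁₃ , ¬f₁₄ , ¬f₂₄)
      where
      f₁₂ = proj₂ (edge⁻ e₁₂)
      f₂₃ = proj₂ (edge⁻ e₂₃)
      f₃₄ = proj₂ (edge⁻ e₃₄)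
      r₂₃ = proj₁ (edge⁻ e₂₃)
      r₁₃ = ≈-trans (proj₁ (edge⁻ e₁₂)) r₂₃
      r₃₄ = proj₁ (edge⁻ e₃₄)
      ¬f₁₃ : ¬ Edge GP (snd i₁) (snd i₃)
      ¬f₁₃ = ¬e₁₃ ∘ edge⁺ r₁₃
      ¬f₁₄ : ¬ Edge GP (snd i₁) (snd i₄)
      ¬f₁₄ = ¬e₁₄ ∘ edge⁺ (≈-trans r₁₃ r₃₄)
      ¬f₂₄ : ¬ Edge GP (snd i₂) (snd i₄)
      ¬f₂₄ = ¬e₂₄ ∘ edge⁺ (≈-trans r₂₃ r₃₄)
      x₁≢x₃ : snd i₁ ≢ snd i₃
      x₁≢x₃ x₁≡x₃ = ¬f₁₄ (subst (λ x → Edge GP x (snd i₄)) (≡.sym x₁≡x₃) f₃₄)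
      x₂≢x₄ : snd i₂ ≢ snd i₄
      x₂≢x₄ x₂≡x₄ = ¬f₁₄ (subst (Edge GP (snd i₁)) x₂≡x₄ f₁₂)
      x₁≢x₄ : snd i₁ ≢ snd i₄
      x₁≢x₄ x₁≡x₄ = ¬f₂₄ (edge-sym GP (subst (λ x → Edge GP x (snd i₂)) x₁≡x₄ f₁₂))

  product : CombProp
  product = record { graph = productGraph ; cograph = isCograph ; label = label P ∘ snd }

  component-within-class : ∀ {K} → Component productGraph K → ∀ {i j} → i ∈ K → j ∈ K → fst i ≈ fst j
  component-within-class (_ , _ , K-connected , _) {i} i∈K j∈K =
    edge-closed⇒all productGraph (λ j → fst i ≈? fst j) K-connected
      (λ _ _ _ _ ia ab → ≈-trans ia (proj₁ (edge⁻ ab))) i∈K ≈-refl _ j∈K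

  slice : VSet productGraph → Fin m → VSet GP
  slice S' u x = S' (pair u x)

  lift : VSet GP → VSet productGraph
  lift S i = S (snd i)

  slice-stable : ∀ {S'} u → Stable productGraph S' → Stable GP (slice S' u)
  slice-stable u S'-stable x y x∈S y∈S = S'-stable _ _ x∈S y∈S ∘ pair-edge⁺ ≈-refl

  clause-∋-pair : ∀ {S'} → IsClause productGraph S' → ∀ {i u} → i ∈ S' → fst i ≈ u → pair u (snd i) ∈ S'
  clause-∋-pair S'-clause {i} {u} i∈S' iu =
    clause-∋-if-neighbours-⊆ productGraph S'-clause i∈S' λ v v-ux →
      edge⁺ (≈-trans (proj₁ (edge-to-pair v-ux)) (≈-sym iu)) (proj₂ (edge-to-pair v-ux))
    where
    edge-to-pair : ∀ {v} → Edge productGraph v (pair u (snd i)) → fst v ≈ u × Edge GP (snd v) (snd i)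
    edge-to-pair vux with pair-edge⁻ (edge-sym productGraph vux)
    ... | uv , xv = ≈-sym uv , edge-sym GP xv

  slice-clause : ∀ {S'} u → IsClause productGraph S' → IsClause GP (slice S' u)
  slice-clause {S'} u S'-clause@(S'-stable , S'-maximal) = slice-stable u S'-stable , maximal
    where
    maximal : ∀ T → Stable GP T → slice S' u ⊆ T → T ⊆ slice S' u
    maximal T T-stable S⊆T y y∈T =
      S'-maximal (S' ∪ T↑) T'-stable (λ _ → ∈-∪⁺ˡ) (pair u y)
        (∈-∪⁺ʳ (∈-∩⁺ (∈⟦⟧⁺ _ (≈-reflexive (fst-pair u y))) (subst (_∈ T) (≡.sym (snd-pair u y)) y∈T)))
      where
      T↑ : VSet productGraph
      T↑ = ⟦ (λ j → fst j ≈? u) ⟧ ∩ lift T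
      mixed : ∀ v w → v ∈ S' → w ∈ T↑ → ¬ Edge productGraph v w
      mixed v w v∈S' w∈T↑ vw with ∈-∩⁻ w∈T↑ | edge⁻ vw
      ... | wu , w∈T | vw≈ , f =
        T-stable (snd v) (snd w) (S⊆T (snd v) (clause-∋-pair S'-clause v∈S' (≈-trans vw≈ (∈⟦⟧⁻ _ wu)))) w∈T f
      T'-stable : Stable productGraph (S' ∪ T↑)
      T'-stable v w v∈ w∈ vw with ∈-∪⁻ S' T↑ v v∈ | ∈-∪⁻ S' T↑ w w∈
      ... | inj₁ v∈S' | inj₁ w∈S' = S'-stable v w v∈S' w∈S' vw
      ... | inj₁ v∈S' | inj₂ w∈T↑ = mixed v w v∈S' w∈T↑ vw
      ... | inj₂ v∈T↑ | inj₁ w∈S' = mixed w v w∈S' v∈T↑ (edge-sym productGraph vw)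
      ... | inj₂ v∈T↑ | inj₂ w∈T↑ =
        T-stable _ _ (proj₂ (∈-∩⁻ v∈T↑)) (proj₂ (∈-∩⁻ w∈T↑)) (proj₂ (edge⁻ vw))

  lift-clause : ∀ {S} → IsClause GP S → IsClause productGraph (lift S)
  lift-clause {S} (S-stable , S-maximal) = stable , maximal
    where
    stable : Stable productGraph (lift S)
    stable v w v∈S w∈S = S-stable _ _ v∈S w∈S ∘ proj₂ ∘ edge⁻
    maximal : ∀ T' → Stable productGraph T' → lift S ⊆ T' → T' ⊆ lift S
    maximal T' T'-stable S⊆T' j j∈T' =
      S-maximal (slice T' (fst j)) (slice-stable (fst j) T'-stable) S⊆T (snd j)
        (subst (_∈ T') (≡.sym (pair-fst-snd j)) j∈T')
      where
      S⊆T : S ⊆ slice T' (fst j)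
      S⊆T x x∈S = S⊆T' (pair (fst j) x) (subst (_∈ S) (≡.sym (snd-pair (fst j) x)) x∈S)

  isTrue⇔ : IsTrue P ⇔ IsTrue product
  isTrue⇔ = mk⇔
    (λ P-true S' S'-clause →
      trueClause-map P product (pair u₀) (cong (label P) ∘ snd-pair u₀) (λ _ x∈S → x∈S)
        (P-true (slice S' u₀) (slice-clause u₀ S'-clause)))
    (λ P'-true S S-clause →
      trueClause-map product P snd (λ _ → refl) (λ _ i∈S → i∈S) (P'-true (lift S) (lift-clause S-clause)))
    where
    u₀ : Fin m
    u₀ = fromℕ< m≥1

module Shallowing (C : ColouredGraph) (P : CombProp) (C-cograph : IsCograph (ColouredGraph.graph C))
                  (h : Fin (n (ColouredGraph.graph C)) → Fin (n (graph P))) where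

  private
    G : Graph
    G = ColouredGraph.graph C

  open ClassProduct (dist≤2-isDecEquivalence {G} C-cograph) (proj₁ C-cograph) P public

  h' : Fin (n G) → Fin (n productGraph)
  h' v = pair v (h v)

  h'-hom : IsHom G (graph P) h → IsHom G productGraph h'
  h'-hom h-hom v w vw = pair-edge⁺ (inj₂ (inj₁ vw)) (h-hom v w vw)

  h'-skewFibration : IsSkewFibration G (graph P) h → IsSkewFibration G productGraph h'
  h'-skewFibration (h-hom , h-skew) = h'-hom h-hom , h'-skew
    where
    h'-skew : ∀ v j → Edge productGraph (h' v) j → ∃[ ŵ ] (Edge G v ŵ × ¬ Edge productGraph (h' ŵ) j)
    h'-skew v j h'v-j with h-skew v (snd j) (proj₂ (pair-edge⁻ h'v-j))
    ... | ŵ , vŵ , ¬hŵ-j = ŵ , vŵ , ¬hŵ-j ∘ proj₂ ∘ pair-edge⁻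

  label-h' : ∀ u → label product (h' u) ≡ label P (h u)
  label-h' u = cong (label P) (snd-pair u (h u))

  h'-axiomatic : Axiomatic C P h → Axiomatic C product h'
  h'-axiomatic h-axiomatic v with h-axiomatic v
  ... | inj₁ (singleton , hv≡𝟙) = inj₁ (singleton , ≡.trans (label-h' v) hv≡𝟙)
  ... | inj₂ (w , w≢v , v∼w , pair-class , dual) =
    inj₂ (w , w≢v , v∼w , pair-class , subst₂ Dual (≡.sym (label-h' v)) (≡.sym (label-h' w)) dual)

  h'-shallow : IsHom G (graph P) h → IsShallow G productGraph h'
  h'-shallow h-hom K K-component K₁ K₂ K₁-component K₂-component x =
    ≡.trans (component-of-connected G K₁-component preimage-connected x)
            (≡.sym (component-of-connected G K₂-component preimage-connected x))
    where
    -- the middle vertex of a two-edge path is mapped into K because K is closed under edges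
    close : ∀ a b → h' a ∈ K → h' b ∈ K → a ≡ b ⊎ Edge G a b ⊎ ∃[ z ] (h' z ∈ K × Edge G a z × Edge G z b)
    close a b a∈K b∈K
      with subst₂ (Dist≤2 G) (fst-pair a (h a)) (fst-pair b (h b)) (component-within-class K-component a∈K b∈K)
    ... | inj₁ a≡b = inj₁ a≡b
    ... | inj₂ (inj₁ ab) = inj₂ (inj₁ ab)
    ... | inj₂ (inj₂ (z , az , zb)) =
      inj₂ (inj₂ (z , component-closed productGraph K-component a∈K (h'-hom h-hom a z az) , az , zb))
    preimage-connected : Connected G (λ v → K (h' v))
    preimage-connected = diameter≤2⇒connected G close

lemma6 : (G : ColouredGraph) (P : CombProp)
           (h : Fin (n (ColouredGraph.graph G)) → Fin (n (graph P))) →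
           IsCombProof G P h →
           ∃[ P' ] ∃[ h' ] (IsCombProof G P' h' ×
             IsShallow (ColouredGraph.graph G) (graph P') h' ×
             (IsTrue P ⇔ IsTrue P'))
lemma6 C P h (C-cograph , C-nice , h-skewFibration , h-axiomatic) =
  product , h' ,
  (C-cograph , C-nice , h'-skewFibration h-skewFibration , h'-axiomatic h-axiomatic) ,
  h'-shallow (proj₁ h-skewFibration) ,
  isTrue⇔
  where open Shallowing C P C-cograph h
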